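{- For any groupoid $(G,*)$ and every $n\ge1$, $s^{ac}_n(*)\le n!\cdot s_n(*)$. Moreover, this inequality holds as an equality if $(G,*)$ is noncommutative and has an identity element.
   Context: A groupoid $(G,*)$ is a set with a binary operation. $\mathcal B_n$ is the set of bracketings of the word $x_1x_2\cdots x_n$ (all ways to insert parentheses), and $\mathcal F_n$ is the set of full linear terms, obtained from bracketings by permuting the variables (each of $x_1,\dots,x_n$ occurs exactly once). Each such term $t$ induces an $n$-ary operation $t^*$ on $G$ by evaluation. The associative spectrum is $s_n(*):=|\{t^*:t\in\mathcal B_n\}|$ and the associative-commutative spectrum is $s^{ac}_n(*):=|\{t^*:t\in\mathcal F_n\}|$. -}

module Defs where

open import Data.Nat using (ℕ; suc; _+_)
open import Data.Fin using (Fin; zero; _↑ˡ_; _↑ʳ_)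
open import Data.Fin.Permutation using (Permutation′; _⟨$⟩ʳ_)
open import Data.Product using (Σ; ∃; _×_; _,_)
open import Data.Empty using (⊥)
open import Relation.Binary.PropositionalEquality using (_≡_)
open import Relation.Nullary using (¬_)

-- Bracketings of x₁x₂⋯xₙ : binary trees with n leaves,
-- the leaves being read as x₁,…,xₙ from left to right.
data Bracketing : ℕ → Set where
  leaf : Bracketing 1
  node : ∀ {m k} → Bracketing m → Bracketing k → Bracketing (m + k)

evalB : {G : Set} → (G → G → G) → ∀ {n} → Bracketing n → (Fin n → G) → G
evalB _*_ leaf ρ = ρ zero
evalB _*_ (node {m} {k} s t) ρ =
  evalB _*_ s (λ i → ρ (i ↑ˡ k)) * evalB _*_ t (λ j → ρ (m ↑ʳ j))

-- Full linear terms: a bracketing together with a permutation σ of the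
-- variables; the i-th leaf (from the left) carries the variable x_{σ(i)}.
-- (Bracketing n × Permutation n) ↦ labelled term is a bijection onto 𝓕ₙ.
FullLinear : ℕ → Set
FullLinear n = Bracketing n × Permutation′ n

evalF : {G : Set} → (G → G → G) → ∀ {n} → FullLinear n → (Fin n → G) → G
evalF _*_ (t , σ) ρ = evalB _*_ t (λ i → ρ (σ ⟨$⟩ʳ i))

SameOp : {G : Set} {n : ℕ} → ((Fin n → G) → G) → ((Fin n → G) → G) → Set
SameOp f g = ∀ ρ → f ρ ≡ g ρ

-- "The set {t* : t ∈ T} of induced operations has exactly k elements":
-- there are k terms whose operations are pairwise distinct, and every
-- term's operation equals one of them.
HasNumberOfOps : {G : Set} {n : ℕ} (T : Set) → (T → (Fin n → G) → G) → ℕ → Set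
HasNumberOfOps T ev k =
  Σ (Fin k → T) λ rep →
    (∀ i j → SameOp (ev (rep i)) (ev (rep j)) → i ≡ j) ×
    (∀ t → ∃ λ i → SameOp (ev t) (ev (rep i)))

AssocSpectrum : (G : Set) → (G → G → G) → ℕ → ℕ → Set
AssocSpectrum G _*_ n k = HasNumberOfOps {G} {n} (Bracketing n) (evalB _*_) k

ACSpectrum : (G : Set) → (G → G → G) → ℕ → ℕ → Set
ACSpectrum G _*_ n k = HasNumberOfOps {G} {n} (FullLinear n) (evalF _*_) k

NonCommutative : (G : Set) → (G → G → G) → Set
NonCommutative G _*_ = ∃ λ (x : G) → ∃ λ (y : G) → ¬ (x * y ≡ y * x)

HasIdentity : (G : Set) → (G → G → G) → Set
HasIdentity G _*_ = ∃ λ (e : G) → ∀ x → (e * x ≡ x) × (x * e ≡ x)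

-- The operation of a full linear term (t , σ) depends only on σ and on the
-- operation t* of its bracketing, which gives s^{ac}_n ≤ n! · s_n.  Conversely,
-- if e is an identity and x * y ≠ y * x, substitute x and y for two variables
-- and e for all others: every bracketing then evaluates to x * y or y * x
-- according to which of the two variables comes first.  So the operation of a
-- full linear term determines the relative order of any two variables, hence
-- its permutation (a strictly monotone permutation is the identity), and then,
-- undoing the permutation, the operation t*.
module Submission where

open import Defs
open import Data.Nat using (ℕ; _*_; _≤_; _!)
open import Data.Product using (_×_)
open import Relation.Binary.PropositionalEquality using (_≡_)

open import Data.Nat using (zero; suc; _+_; z≤n; s≤s; s≤s⁻¹)
import Data.Nat.Properties as ℕ
open import Data.Fin as Fin using (Fin; zero; suc; _↑ˡ_; _↑ʳ_; _<_; inject₁; punchIn; punchOut; combine; remQuot)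
import Data.Fin.Properties as FinP
open import Data.Fin.Induction using (<-weakInduction; >-weakInduction)
open import Data.Fin.Permutation using (Permutation′; _⟨$⟩ʳ_; _⟨$⟩ˡ_; _≈_; inverseˡ; inverseʳ; remove; insert; remove-insert)
import Data.Fin.Permutation as Permutation
open import Data.Product using (_,_; proj₁; proj₂)
open import Data.Maybe using (Maybe; just; nothing; fromMaybe)
open import Data.List using (List; []; _∷_; _++_; length; tabulate; catMaybes)
open import Data.List.Properties using (length-++; catMaybes-++)
open import Data.Empty using (⊥-elim)
open import Function using (_∘_)
open import Relation.Binary.Core using (_Preserves_⟶_)
open import Relation.Binary.Definitions using (Tri; tri<; tri≈; tri>)
open import Relation.Binary.PropositionalEquality using (refl; sym; trans; cong; cong₂; subst₂; _≢_; module ≡-Reasoning)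
open import Relation.Nullary using (yes; no)

module _ {G : Set} {n : ℕ} {T : Set} {ev : T → (Fin n → G) → G} {k : ℕ} where

  classOf : HasNumberOfOps T ev k → T → Fin k
  classOf (_ , _ , cover) t = proj₁ (cover t)

  sameClass⇒sameOp : (count : HasNumberOfOps T ev k) {t u : T} →
                     classOf count t ≡ classOf count u → SameOp (ev t) (ev u)
  sameClass⇒sameOp (rep , _ , cover) {t} {u} eq ρ =
    trans (proj₂ (cover t) ρ)
      (trans (cong (λ i → ev (rep i) ρ) eq) (sym (proj₂ (cover u) ρ)))

  numberOfOps-≤ : HasNumberOfOps T ev k → {N : ℕ} (label : T → Fin N) →
                  (∀ t u → label t ≡ label u → SameOp (ev t) (ev u)) → k ≤ N
  numberOfOps-≤ (rep , distinct , _) label label-reflects =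
    FinP.injective⇒≤ λ {i} {j} eq → distinct i j (label-reflects (rep i) (rep j) eq)

  numberOfOps-≥ : (count : HasNumberOfOps T ev k) {N : ℕ} (term : Fin N → T) →
                  (∀ c d → SameOp (ev (term c)) (ev (term d)) → c ≡ d) → N ≤ k
  numberOfOps-≥ count term term-separates =
    FinP.injective⇒≤ λ {c} {d} eq → term-separates c d (sameClass⇒sameOp count eq)

code : ∀ {n} → Permutation′ n → Fin (n !)
code {zero}  π = zero
code {suc n} π = combine (π ⟨$⟩ʳ zero) (code (remove zero π))

decode : ∀ {n} → Fin (n !) → Permutation′ n
decode {zero}  c = Permutation.id
decode {suc n} c = insert zero (proj₁ (remQuot {suc n} (n !) c)) (decode (proj₂ (remQuot {suc n} (n !) c)))

remove-zero-cong : ∀ {n} (π τ : Permutation′ (suc n)) → π ≈ τ → remove zero π ≈ remove zero τ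
remove-zero-cong π τ π≈τ j = punchOut-cong₂ (π≈τ zero) (π≈τ (suc j))
  where
  punchOut-cong₂ : ∀ {n} {i i′ j j′ : Fin (suc n)} {i≢j : i ≢ j} {i′≢j′ : i′ ≢ j′} →
                   i ≡ i′ → j ≡ j′ → punchOut i≢j ≡ punchOut i′≢j′
  punchOut-cong₂ {i = i} refl refl = FinP.punchOut-cong i refl

code-cong : ∀ {n} (π τ : Permutation′ n) → π ≈ τ → code π ≡ code τ
code-cong {zero}  π τ π≈τ = refl
code-cong {suc n} π τ π≈τ =
  cong₂ combine (π≈τ zero) (code-cong (remove zero π) (remove zero τ) (remove-zero-cong π τ π≈τ))

code-suc-injective : ∀ {n} (π τ : Permutation′ (suc n)) → code π ≡ code τ →
                     π ⟨$⟩ʳ zero ≡ τ ⟨$⟩ʳ zero × code (remove zero π) ≡ code (remove zero τ)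
code-suc-injective π τ = FinP.combine-injective _ _ _ _

code-injective : ∀ {n} (π τ : Permutation′ n) → code π ≡ code τ → π ≈ τ
code-injective {zero}  π τ eq ()
code-injective {suc n} π τ eq zero = proj₁ (code-suc-injective π τ eq)
code-injective {suc n} π τ eq (suc j) = begin
  π ⟨$⟩ʳ suc j                                   ≡⟨ FinP.punchIn-punchOut _ ⟨
  punchIn (π ⟨$⟩ʳ zero) (remove zero π ⟨$⟩ʳ j)   ≡⟨ cong₂ punchIn heads (code-injective _ _ tails j) ⟩
  punchIn (τ ⟨$⟩ʳ zero) (remove zero τ ⟨$⟩ʳ j)   ≡⟨ FinP.punchIn-punchOut _ ⟩
  τ ⟨$⟩ʳ suc j                                   ∎
  where
  open ≡-Reasoning
  heads = proj₁ (code-suc-injective π τ eq)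
  tails = proj₂ (code-suc-injective π τ eq)

code-decode : ∀ {n} (c : Fin (n !)) → code {n} (decode c) ≡ c
code-decode {zero}  zero = refl
code-decode {suc n} c = begin
  code (insert zero a π)   ≡⟨ cong (combine a) (code-cong _ π (remove-insert zero a π)) ⟩
  combine a (code π)       ≡⟨ cong (combine a) (code-decode {n} b) ⟩
  combine a b              ≡⟨ FinP.combine-remQuot {suc n} (n !) c ⟩
  c                        ∎
  where
  open ≡-Reasoning
  a = proj₁ (remQuot {suc n} (n !) c)
  b = proj₂ (remQuot {suc n} (n !) c)
  π = decode {n} b

decode-injective : ∀ {n} (c d : Fin (n !)) → decode {n} c ≈ decode d → c ≡ d
decode-injective {n} c d eq =
  trans (sym (code-decode {n} c)) (trans (code-cong (decode c) (decode d) eq) (code-decode {n} d))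

strictMono⇒inflationary : ∀ {n} {f : Fin n → Fin n} → f Preserves _<_ ⟶ _<_ → ∀ i → i Fin.≤ f i
strictMono⇒inflationary {suc n} {f} mono = <-weakInduction (λ i → i Fin.≤ f i) z≤n step
  where
  step : ∀ i → inject₁ i Fin.≤ f (inject₁ i) → suc i Fin.≤ f (suc i)
  step i ih = ℕ.≤-<-trans (subst₂ _≤_ (FinP.toℕ-inject₁ i) refl ih)
                          (mono (FinP.≤̄⇒inject₁< FinP.≤-refl))

strictMono⇒deflationary : ∀ {n} {f : Fin n → Fin n} → f Preserves _<_ ⟶ _<_ → ∀ i → f i Fin.≤ i
strictMono⇒deflationary {suc n} {f} mono = >-weakInduction (λ i → f i Fin.≤ i) (FinP.≤fromℕ _) step
  where
  step : ∀ i → f (suc i) Fin.≤ suc i → f (inject₁ i) Fin.≤ inject₁ i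
  step i ih = subst₂ _≤_ refl (sym (FinP.toℕ-inject₁ i))
                (s≤s⁻¹ (ℕ.<-≤-trans (mono (FinP.≤̄⇒inject₁< FinP.≤-refl)) ih))

strictMono⇒id : ∀ {n} {f : Fin n → Fin n} → f Preserves _<_ ⟶ _<_ → ∀ i → f i ≡ i
strictMono⇒id mono i =
  FinP.≤-antisym (strictMono⇒deflationary mono i) (strictMono⇒inflationary mono i)

tabulate-++ : ∀ {A : Set} a {b} (f : Fin (a + b) → A) →
              tabulate f ≡ tabulate (f ∘ (_↑ˡ b)) ++ tabulate (f ∘ (a ↑ʳ_))
tabulate-++ zero    f = refl
tabulate-++ (suc a) f = cong (f zero ∷_) (tabulate-++ a (f ∘ suc))

module _ {G : Set} (_∙_ : G → G → G) where

  evalB-cong : ∀ {n} (s : Bracketing n) {ρ ρ′ : Fin n → G} →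
               (∀ i → ρ i ≡ ρ′ i) → evalB _∙_ s ρ ≡ evalB _∙_ s ρ′
  evalB-cong leaf       eq = eq zero
  evalB-cong (node s t) eq = cong₂ _∙_ (evalB-cong s (eq ∘ _)) (evalB-cong t (eq ∘ _))

  evalF-cong : ∀ {n} (s t : Bracketing n) (σ τ : Permutation′ n) → σ ≈ τ →
               SameOp (evalB _∙_ s) (evalB _∙_ t) → SameOp (evalF _∙_ (s , σ)) (evalF _∙_ (t , τ))
  evalF-cong s t σ τ σ≈τ s≗t ρ = trans (s≗t _) (evalB-cong t (cong ρ ∘ σ≈τ))

  sameOp⇒sameBracketing : ∀ {n} (s t : Bracketing n) (σ τ : Permutation′ n) → σ ≈ τ →
                          SameOp (evalF _∙_ (s , σ)) (evalF _∙_ (t , τ)) →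
                          SameOp (evalB _∙_ s) (evalB _∙_ t)
  sameOp⇒sameBracketing s t σ τ σ≈τ same ρ = begin
    evalB _∙_ s ρ                        ≡⟨ evalB-cong s (λ i → cong ρ (inverseˡ σ)) ⟨
    evalF _∙_ (s , σ) (ρ ∘ (σ ⟨$⟩ˡ_))    ≡⟨ same (ρ ∘ (σ ⟨$⟩ˡ_)) ⟩
    evalF _∙_ (t , τ) (ρ ∘ (σ ⟨$⟩ˡ_))    ≡⟨ evalB-cong t (λ i → cong ρ (trans (cong (σ ⟨$⟩ˡ_) (sym (σ≈τ i))) (inverseˡ σ))) ⟩
    evalB _∙_ t ρ                        ∎
    where open ≡-Reasoning

-- A valuation ρ : Fin n → Maybe G stands for pad ∘ ρ, with nothing read as the
-- identity; its support lists the non-identity values from left to right.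
module WithIdentity {G : Set} (_∙_ : G → G → G) (e : G)
                    (identity : ∀ x → e ∙ x ≡ x × x ∙ e ≡ x) where

  pad : Maybe G → G
  pad = fromMaybe e

  support : ∀ {n} → (Fin n → Maybe G) → List G
  support ρ = catMaybes (tabulate ρ)

  -- Only meaningful on words of length at most 2.
  product≤2 : List G → G
  product≤2 []          = e
  product≤2 (u ∷ [])    = u
  product≤2 (u ∷ v ∷ _) = u ∙ v

  product≤2-++ : ∀ w w′ → length w + length w′ ≤ 2 →
                 product≤2 w ∙ product≤2 w′ ≡ product≤2 (w ++ w′)
  product≤2-++ []               w′            _ = proj₁ (identity _)
  product≤2-++ (u ∷ [])         []            _ = proj₂ (identity u)
  product≤2-++ (u ∷ [])         (v ∷ [])      _ = refl
  product≤2-++ (u ∷ [])         (v ∷ _ ∷ _)   (s≤s (s≤s ()))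
  product≤2-++ (u ∷ v ∷ [])     []            _ = proj₂ (identity (u ∙ v))
  product≤2-++ (u ∷ v ∷ _ ∷ _)  []            (s≤s (s≤s ()))
  product≤2-++ (u ∷ v ∷ w)      (_ ∷ w′)      (s≤s (s≤s le))
    with () ← ℕ.m+n≤o⇒n≤o (length w) le

  support-++ : ∀ a {b} (ρ : Fin (a + b) → Maybe G) →
               support ρ ≡ support (ρ ∘ (_↑ˡ b)) ++ support (ρ ∘ (a ↑ʳ_))
  support-++ a {b} ρ = trans (cong catMaybes (tabulate-++ a ρ))
                             (catMaybes-++ (tabulate (ρ ∘ (_↑ˡ b))) (tabulate (ρ ∘ (a ↑ʳ_))))

  evalB-support : ∀ {n} (s : Bracketing n) (ρ : Fin n → Maybe G) → length (support ρ) ≤ 2 →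
                  evalB _∙_ s (pad ∘ ρ) ≡ product≤2 (support ρ)
  evalB-support leaf ρ _ with ρ zero
  ... | nothing = refl
  ... | just u  = refl
  evalB-support (node {a} {b} s t) ρ short = begin
    evalB _∙_ s (pad ∘ ρˡ) ∙ evalB _∙_ t (pad ∘ ρʳ)
      ≡⟨ cong₂ _∙_ (evalB-support s ρˡ (ℕ.m+n≤o⇒m≤o (length wˡ) short′))
                   (evalB-support t ρʳ (ℕ.m+n≤o⇒n≤o (length wˡ) short′)) ⟩
    product≤2 wˡ ∙ product≤2 wʳ
      ≡⟨ product≤2-++ wˡ wʳ short′ ⟩
    product≤2 (wˡ ++ wʳ)
      ≡⟨ cong product≤2 (support-++ a ρ) ⟨
    product≤2 (support ρ)
      ∎
    where
    open ≡-Reasoning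
    ρˡ = ρ ∘ (_↑ˡ b)
    ρʳ = ρ ∘ (a ↑ʳ_)
    wˡ = support ρˡ
    wʳ = support ρʳ
    short′ : length wˡ + length wʳ ≤ 2
    short′ = ℕ.≤-trans (ℕ.≤-reflexive (sym (trans (cong length (support-++ a ρ)) (length-++ wˡ))))
                       short

  support-none : ∀ {n} (ρ : Fin n → Maybe G) → (∀ l → ρ l ≡ nothing) → support ρ ≡ []
  support-none {zero}  ρ none = refl
  support-none {suc n} ρ none rewrite none zero = support-none (ρ ∘ suc) (none ∘ suc)

  support-single : ∀ {n} (ρ : Fin n → Maybe G) {q v} → ρ q ≡ just v →
                   (∀ l → l ≢ q → ρ l ≡ nothing) → support ρ ≡ v ∷ []
  support-single ρ {zero} ρq rest rewrite ρq =
    cong (_ ∷_) (support-none (ρ ∘ suc) (λ l → rest (suc l) λ ()))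
  support-single ρ {suc q} ρq rest rewrite rest zero (λ ()) =
    support-single (ρ ∘ suc) ρq (λ l l≢q → rest (suc l) (l≢q ∘ FinP.suc-injective))

  support-pair : ∀ {n} (ρ : Fin n → Maybe G) {p q u v} → p < q → ρ p ≡ just u → ρ q ≡ just v →
                 (∀ l → l ≢ p → l ≢ q → ρ l ≡ nothing) → support ρ ≡ u ∷ v ∷ []
  support-pair ρ {zero} {suc q} _ ρp ρq rest rewrite ρp =
    cong (_ ∷_) (support-single (ρ ∘ suc) ρq (λ l l≢q → rest (suc l) (λ ()) (l≢q ∘ FinP.suc-injective)))
  support-pair ρ {suc p} {suc q} (s≤s p<q) ρp ρq rest rewrite rest zero (λ ()) (λ ()) =
    support-pair (ρ ∘ suc) p<q ρp ρq
      (λ l l≢p l≢q → rest (suc l) (l≢p ∘ FinP.suc-injective) (l≢q ∘ FinP.suc-injective))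

  evalB-pair : ∀ {n} (s : Bracketing n) (ρ : Fin n → Maybe G) {p q u v} → p < q →
               ρ p ≡ just u → ρ q ≡ just v → (∀ l → l ≢ p → l ≢ q → ρ l ≡ nothing) →
               evalB _∙_ s (pad ∘ ρ) ≡ u ∙ v
  evalB-pair s ρ p<q ρp ρq rest =
    trans (evalB-support s ρ (ℕ.≤-reflexive (cong length pair))) (cong product≤2 pair)
    where
    pair = support-pair ρ p<q ρp ρq rest

  evalF-pair : ∀ {n} (s : Bracketing n) (σ : Permutation′ n) (ν : Fin n → Maybe G) {a b u v} →
               σ ⟨$⟩ˡ a < σ ⟨$⟩ˡ b → ν a ≡ just u → ν b ≡ just v →
               (∀ l → l ≢ a → l ≢ b → ν l ≡ nothing) →
               evalF _∙_ (s , σ) (pad ∘ ν) ≡ u ∙ v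
  evalF-pair s σ ν lt νa νb rest =
    evalB-pair s (ν ∘ (σ ⟨$⟩ʳ_)) lt
      (trans (cong ν (inverseʳ σ)) νa) (trans (cong ν (inverseʳ σ)) νb)
      (λ l l≢a l≢b → rest _ (l≢a ∘ moved) (l≢b ∘ moved))
    where
    moved : ∀ {l c} → σ ⟨$⟩ʳ l ≡ c → l ≡ σ ⟨$⟩ˡ c
    moved eq = trans (sym (inverseˡ σ)) (cong (σ ⟨$⟩ˡ_) eq)

  twoPoint : ∀ {n} → Fin n → G → Fin n → G → Fin n → Maybe G
  twoPoint a u b v l with l FinP.≟ a
  ... | yes _ = just u
  ... | no _ with l FinP.≟ b
  ...   | yes _ = just v
  ...   | no _  = nothing

  twoPoint-first : ∀ {n} (a : Fin n) u b v → twoPoint a u b v a ≡ just u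
  twoPoint-first a u b v with a FinP.≟ a
  ... | yes _   = refl
  ... | no a≢a = ⊥-elim (a≢a refl)

  twoPoint-second : ∀ {n} {a b : Fin n} u v → a ≢ b → twoPoint a u b v b ≡ just v
  twoPoint-second {a = a} {b} u v a≢b with b FinP.≟ a
  ... | yes b≡a = ⊥-elim (a≢b (sym b≡a))
  ... | no _ with b FinP.≟ b
  ...   | yes _   = refl
  ...   | no b≢b = ⊥-elim (b≢b refl)

  twoPoint-elsewhere : ∀ {n} {a b : Fin n} u v l → l ≢ a → l ≢ b → twoPoint a u b v l ≡ nothing
  twoPoint-elsewhere {a = a} {b} u v l l≢a l≢b with l FinP.≟ a
  ... | yes l≡a = ⊥-elim (l≢a l≡a)
  ... | no _ with l FinP.≟ b
  ...   | yes l≡b = ⊥-elim (l≢b l≡b)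
  ...   | no _    = refl

  module _ {x y : G} (x∙y≢y∙x : x ∙ y ≢ y ∙ x) where

    sameOp⇒sameOrder : ∀ {n} (s t : Bracketing n) (σ τ : Permutation′ n) →
                       SameOp (evalF _∙_ (s , σ)) (evalF _∙_ (t , τ)) →
                       ∀ {a b} → σ ⟨$⟩ˡ a < σ ⟨$⟩ˡ b → τ ⟨$⟩ˡ a < τ ⟨$⟩ˡ b
    sameOp⇒sameOrder s t σ τ same {a} {b} σa<σb =
      fromComparison (FinP.<-cmp (τ ⟨$⟩ˡ a) (τ ⟨$⟩ˡ b))
      where
      open ≡-Reasoning
      a≢b : a ≢ b
      a≢b = FinP.<⇒≢ σa<σb ∘ cong (σ ⟨$⟩ˡ_)
      ν = twoPoint a x b y
      rest : ∀ l → l ≢ a → l ≢ b → ν l ≡ nothing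
      rest = twoPoint-elsewhere x y
      fromComparison : Tri (τ ⟨$⟩ˡ a < τ ⟨$⟩ˡ b) (τ ⟨$⟩ˡ a ≡ τ ⟨$⟩ˡ b) (τ ⟨$⟩ˡ b < τ ⟨$⟩ˡ a) →
                       τ ⟨$⟩ˡ a < τ ⟨$⟩ˡ b
      fromComparison (tri< τa<τb _ _) = τa<τb
      fromComparison (tri≈ _ τa≡τb _) =
        ⊥-elim (a≢b (trans (sym (inverseʳ τ)) (trans (cong (τ ⟨$⟩ʳ_) τa≡τb) (inverseʳ τ))))
      fromComparison (tri> _ _ τb<τa) = ⊥-elim (x∙y≢y∙x (begin
        x ∙ y                         ≡⟨ evalF-pair s σ ν σa<σb (twoPoint-first a x b y) (twoPoint-second x y a≢b) rest ⟨
        evalF _∙_ (s , σ) (pad ∘ ν)   ≡⟨ same (pad ∘ ν) ⟩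
        evalF _∙_ (t , τ) (pad ∘ ν)   ≡⟨ evalF-pair t τ ν τb<τa (twoPoint-second x y a≢b) (twoPoint-first a x b y)
                                           (λ l l≢b l≢a → rest l l≢a l≢b) ⟩
        y ∙ x                         ∎))

    sameOp⇒samePermutation : ∀ {n} (s t : Bracketing n) (σ τ : Permutation′ n) →
                             SameOp (evalF _∙_ (s , σ)) (evalF _∙_ (t , τ)) → σ ≈ τ
    sameOp⇒samePermutation s t σ τ same i = begin
      σ ⟨$⟩ʳ i                       ≡⟨ inverseʳ τ ⟨
      τ ⟨$⟩ʳ (τ ⟨$⟩ˡ (σ ⟨$⟩ʳ i))     ≡⟨ cong (τ ⟨$⟩ʳ_) (strictMono⇒id τ⁻¹∘σ-mono i) ⟩
      τ ⟨$⟩ʳ i                       ∎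
      where
      open ≡-Reasoning
      τ⁻¹∘σ-mono : (λ i → τ ⟨$⟩ˡ (σ ⟨$⟩ʳ i)) Preserves _<_ ⟶ _<_
      τ⁻¹∘σ-mono {i} {j} i<j = sameOp⇒sameOrder s t σ τ same {σ ⟨$⟩ʳ i} {σ ⟨$⟩ʳ j}
        (subst₂ _<_ (sym (inverseˡ σ)) (sym (inverseˡ σ)) i<j)

acSpectrum-upperBound : ∀ {G : Set} (_∙_ : G → G → G) {n k m} →
                        AssocSpectrum G _∙_ n k → ACSpectrum G _∙_ n m → m ≤ (n !) * k
acSpectrum-upperBound _∙_ {n} {k} assoc ac = numberOfOps-≤ ac label label-reflects
  where
  label : FullLinear n → Fin ((n !) * k)
  label (t , σ) = combine (code σ) (classOf assoc t)
  label-reflects : ∀ u w → label u ≡ label w → SameOp (evalF _∙_ u) (evalF _∙_ w)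
  label-reflects (t , σ) (t′ , σ′) eq =
    evalF-cong _∙_ t t′ σ σ′ (code-injective σ σ′ (proj₁ same-parts))
                             (sameClass⇒sameOp assoc (proj₂ same-parts))
    where
    same-parts = FinP.combine-injective (code σ) (classOf assoc t) (code σ′) (classOf assoc t′) eq

acSpectrum-lowerBound : ∀ {G : Set} (_∙_ : G → G → G) {n k m} →
                        NonCommutative G _∙_ → HasIdentity G _∙_ →
                        AssocSpectrum G _∙_ n k → ACSpectrum G _∙_ n m → (n !) * k ≤ m
acSpectrum-lowerBound _∙_ {n} {k} (x , y , x∙y≢y∙x) (e , identity) (repB , distinctB , _) ac =
  numberOfOps-≥ ac term term-separates
  where
  open WithIdentity _∙_ e identity
  permutationIndex : Fin ((n !) * k) → Fin (n !)
  permutationIndex c = proj₁ (remQuot {n !} k c)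
  bracketingIndex : Fin ((n !) * k) → Fin k
  bracketingIndex c = proj₂ (remQuot {n !} k c)
  term : Fin ((n !) * k) → FullLinear n
  term c = repB (bracketingIndex c) , decode (permutationIndex c)
  term-separates : ∀ c d → SameOp (evalF _∙_ (term c)) (evalF _∙_ (term d)) → c ≡ d
  term-separates c d same = begin
    c                                                      ≡⟨ FinP.combine-remQuot {n !} k c ⟨
    combine (permutationIndex c) (bracketingIndex c)       ≡⟨ cong₂ combine samePermutation sameBracketing ⟩
    combine (permutationIndex d) (bracketingIndex d)       ≡⟨ FinP.combine-remQuot {n !} k d ⟩
    d                                                      ∎
    where
    open ≡-Reasoning
    s = repB (bracketingIndex c)
    t = repB (bracketingIndex d)
    σ = decode (permutationIndex c)
    τ = decode (permutationIndex d)
    decodings≈ = sameOp⇒samePermutation x∙y≢y∙x s t σ τ same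
    samePermutation = decode-injective (permutationIndex c) (permutationIndex d) decodings≈
    sameBracketing = distinctB _ _ (sameOp⇒sameBracketing _∙_ s t σ τ decodings≈ same)

theorem7p1 : (G : Set) (_∙_ : G → G → G) (n : ℕ) → 1 ≤ n →
    (k m : ℕ) → AssocSpectrum G _∙_ n k → ACSpectrum G _∙_ n m →
      (m ≤ (n !) * k) ×
      (NonCommutative G _∙_ → HasIdentity G _∙_ → m ≡ (n !) * k)
theorem7p1 G _∙_ n _ k m assoc ac =
  acSpectrum-upperBound _∙_ assoc ac ,
  λ noncommutative unital →
    ℕ.≤-antisym (acSpectrum-upperBound _∙_ assoc ac) (acSpectrum-lowerBound _∙_ noncommutative unital assoc ac)
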